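{- Let $T$ and $T'$ be finite teams of traces. Then $T\equiv^a_{st}T'$ if and only if for all $T_1,T_2$ with $T=T_1\cup T_2$ there are subteams $T'_1,T'_2\subseteq T'$ such that $T'=T'_1\cup T'_2$, $T_1\equiv^a_{st}T'_1$ and $T_2\equiv^a_{st}T'_2$.
   Context: A trace over a set $\mathrm{AP}$ of atomic propositions is $t\in(2^{\mathrm{AP}})^\omega$; a team is a set of traces. A stuttering function of a trace $t$ is a strictly increasing $f\colon\mathbb N\to\mathbb N$ with $f(0)=0$ and $t(f(k))=t(f(k)+1)=\dots=t(f(k+1)-1)$ for all $k$. For $f\colon\mathbb N\to\mathbb N$, $t[f]$ denotes the trace $t(f(0))t(f(1))t(f(2))\dots$. An asynchronous stuttering function of a finite team $T=\{t_1,\dots,t_k\}$ is $F\colon\mathbb N\to\mathbb N^k$, $F(n)=(f_{t_1}(n),\dots,f_{t_k}(n))$, where each $f_{t_i}$ is a stuttering function of $t_i$; then $t[F]$ denotes $t[f_t]$ and $T[F]=\{t[F]\mid t\in T\}$. Teams $T,T'$ are asynchronously stutter-equivalent, $T\equiv^a_{st}T'$, if there are asynchronous stuttering functions $F$ of $T$ and $F'$ of $T'$ with $T[F]=T'[F']$. -}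

module Defs where

open import Data.Bool using (Bool)
open import Data.Nat using (ℕ; zero; suc; _≤_; _<_)
open import Data.Fin using (Fin)
open import Data.List using (List; length; lookup; tabulate; _++_)
open import Data.List.Relation.Unary.Any using (Any)
open import Data.List.Relation.Unary.All using (All)
open import Data.Product using (Σ; _×_)
open import Relation.Binary.PropositionalEquality using (_≡_)

-- A letter of 2^AP is a subset of AP, given by its characteristic function.
Letter : Set → Set
Letter AP = AP → Bool

_≈L_ : {AP : Set} → Letter AP → Letter AP → Set
x ≈L y = ∀ a → x a ≡ y a

Trace : Set → Set
Trace AP = ℕ → Letter AP

_≈T_ : {AP : Set} → Trace AP → Trace AP → Set
t ≈T u = ∀ n → t n ≈L u n

IsStutteringFn : {AP : Set} → Trace AP → (ℕ → ℕ) → Set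
IsStutteringFn t f =
  (f 0 ≡ 0)
  × (∀ k → f k < f (suc k))
  × (∀ k i → f k ≤ i → i < f (suc k) → t i ≈L t (f k))

_[_] : {AP : Set} → Trace AP → (ℕ → ℕ) → Trace AP
(t [ f ]) n = t (f n)

-- A finite team, given by a list of its traces (duplicates, up to ≈T,
-- are allowed and represent the same trace; see consistency below).
Team : Set → Set
Team AP = List (Trace AP)

_∈T_ : {AP : Set} → Trace AP → Team AP → Set
t ∈T T = Any (λ u → t ≈T u) T

_⊆T_ : {AP : Set} → Team AP → Team AP → Set
T ⊆T U = All (λ t → t ∈T U) T

_≡T_ : {AP : Set} → Team AP → Team AP → Set
T ≡T U = (T ⊆T U) × (U ⊆T T)

-- Entries of the list denoting the same
-- trace must receive the same function (so that lists behave as sets).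
record AsyncStutteringFn {AP : Set} (T : Team AP) : Set where
  field
    fun        : Fin (length T) → ℕ → ℕ
    stuttering : ∀ i → IsStutteringFn (lookup T i) (fun i)
    consistent : ∀ i j → lookup T i ≈T lookup T j → ∀ n → fun i n ≡ fun j n

open AsyncStutteringFn public

_⟦_⟧ : {AP : Set} (T : Team AP) → AsyncStutteringFn T → Team AP
T ⟦ F ⟧ = tabulate (λ i → lookup T i [ fun F i ])

_≡ᵃst_ : {AP : Set} → Team AP → Team AP → Set
T ≡ᵃst T' = Σ (AsyncStutteringFn T) λ F → Σ (AsyncStutteringFn T') λ F' →
  (T ⟦ F ⟧) ≡T (T' ⟦ F' ⟧)

-- Restricting an asynchronous stuttering function F of a team U to a subteam S ⊆ U gives
-- one of S whose image S[F] consists exactly of the images t[F] of the traces t ∈ U lying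
-- in S; so two subteams are equivalent as soon as these image sets agree.  Given
-- T[F] = T'[F'] and a split T = T₁ ∪ T₂, put each trace of T' into T₁' or T₂' according to
-- whether its image is that of a trace of T₁ or of T₂, and add to Tₖ', for each trace of
-- Tₖ, a trace of T' with the same image; then Tₖ and Tₖ' have the same image set.
-- Conversely, the split T = T ∪ ∅ can only be matched by T' = T₁' ∪ ∅ with T ≡ᵃst T₁'.

module Submission where

open import Defs
open import Data.List using (_++_)
open import Data.Product using (Σ; _×_)
open import Function.Bundles using (_⇔_)

open import Data.Fin using (Fin)
open import Data.Nat using (ℕ)
open import Data.List using (List; []; _∷_; length; lookup; map; tabulate; allFin)
open import Data.List.Properties using (++-identityʳ)
open import Data.List.Membership.Propositional using (_∈_; find; lose)
open import Data.List.Membership.Propositional.Properties using (∈-lookup; ∈-allFin)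
open import Data.List.Relation.Unary.All as All using (All; []; _∷_)
import Data.List.Relation.Unary.All.Properties as Allₚ
open import Data.List.Relation.Unary.Any as Any using (Any; here; there)
import Data.List.Relation.Unary.Any.Properties as Anyₚ
open import Data.Product using (∃-syntax; _,_; proj₁; proj₂)
open import Data.Sum as Sum using (_⊎_; inj₁; inj₂)
open import Function using (id; _∘_)
open import Function.Bundles using (mk⇔)
open import Relation.Binary.Bundles using (Setoid)
open import Relation.Binary.PropositionalEquality using (_≡_; refl; sym; trans; cong; subst)
import Relation.Binary.Reasoning.Setoid as SetoidReasoning

partition-⊎ : {A : Set} {P Q : A → Set} → (∀ x → P x ⊎ Q x) → (xs : List A) →
  Σ (List A) λ ys → Σ (List A) λ zs →
    All P ys × All Q zs × (∀ {x} → x ∈ xs → x ∈ ys ⊎ x ∈ zs)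
partition-⊎ d [] = [] , [] , [] , [] , λ ()
partition-⊎ d (x ∷ xs) with partition-⊎ d xs | d x
... | ys , zs , pys , qzs , split | inj₁ px =
  x ∷ ys , zs , px ∷ pys , qzs ,
  λ { (here refl) → inj₁ (here refl) ; (there m) → Sum.map₁ there (split m) }
... | ys , zs , pys , qzs , split | inj₂ qx =
  ys , x ∷ zs , pys , qx ∷ qzs ,
  λ { (here refl) → inj₂ (here refl) ; (there m) → Sum.map₂ there (split m) }

module _ {AP : Set} where

  ≈T-refl : {t : Trace AP} → t ≈T t
  ≈T-refl n a = refl

  ≈T-sym : {t u : Trace AP} → t ≈T u → u ≈T t
  ≈T-sym t≈u n a = sym (t≈u n a)

  ≈T-trans : {t u v : Trace AP} → t ≈T u → u ≈T v → t ≈T v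
  ≈T-trans t≈u u≈v n a = trans (t≈u n a) (u≈v n a)

  ≈T-setoid : Setoid _ _
  ≈T-setoid = record
    { Carrier = Trace AP
    ; _≈_ = _≈T_
    ; isEquivalence = record { refl = ≈T-refl ; sym = ≈T-sym ; trans = ≈T-trans }
    }

  [_]-resp-≈T : {t u : Trace AP} (f : ℕ → ℕ) → t ≈T u → (t [ f ]) ≈T (u [ f ])
  [ f ]-resp-≈T t≈u n = t≈u (f n)

  IsStutteringFn-resp-≈T : {t u : Trace AP} {f : ℕ → ℕ} →
    t ≈T u → IsStutteringFn t f → IsStutteringFn u f
  IsStutteringFn-resp-≈T {f = f} t≈u (f0≡0 , increasing , constant) =
    f0≡0 , increasing ,
    λ k i lo hi a → trans (sym (t≈u i a)) (trans (constant k i lo hi a) (t≈u (f k) a))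

  ∈T-resp-≈T : {s t : Trace AP} {U : Team AP} → s ≈T t → t ∈T U → s ∈T U
  ∈T-resp-≈T s≈t = Any.map (≈T-trans s≈t)

  ∈⇒∈T : {t : Trace AP} {U : Team AP} → t ∈ U → t ∈T U
  ∈⇒∈T t∈U = lose t∈U ≈T-refl

  ⊆T⁻ : {U V : Team AP} → U ⊆T V → ∀ {t} → t ∈T U → t ∈T V
  ⊆T⁻ U⊆V t∈U = let t'∈V , t≈t' = All.lookupAny U⊆V t∈U in ∈T-resp-≈T t≈t' t'∈V

  ⊆T⁺ : {U V : Team AP} → (∀ {t} → t ∈T U → t ∈T V) → U ⊆T V
  ⊆T⁺ U⊆V = All.tabulate (U⊆V ∘ ∈⇒∈T)

  ⊆T-trans : {U V W : Team AP} → U ⊆T V → V ⊆T W → U ⊆T W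
  ⊆T-trans U⊆V V⊆W = All.map (⊆T⁻ V⊆W) U⊆V

  ≡T-refl : (U : Team AP) → U ≡T U
  ≡T-refl U = ⊆T⁺ id , ⊆T⁺ id

  lookup-∈T : (U : Team AP) (i : Fin (length U)) → lookup U i ∈T U
  lookup-∈T U i = ∈⇒∈T (∈-lookup i)

  map-lookup-⊆T : (U : Team AP) (J : List (Fin (length U))) → map (lookup U) J ⊆T U
  map-lookup-⊆T U J = Allₚ.map⁺ (All.universal (lookup-∈T U) J)

  ⊆T-++-byIndices : {U V₁ V₂ : Team AP} {P₁ P₂ : List (Fin (length U))} →
    All (λ j → lookup U j ∈T V₁) P₁ → All (λ j → lookup U j ∈T V₂) P₂ →
    (∀ j → j ∈ P₁ ⊎ j ∈ P₂) → U ⊆T (V₁ ++ V₂)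
  ⊆T-++-byIndices {V₁ = V₁} P₁⊆V₁ P₂⊆V₂ split = ⊆T⁺ λ t∈U →
    ∈T-resp-≈T (Anyₚ.lookup-index t∈U)
      (Sum.[ Anyₚ.++⁺ˡ ∘ All.lookup P₁⊆V₁ , Anyₚ.++⁺ʳ V₁ ∘ All.lookup P₂⊆V₂ ]
        (split (Any.index t∈U)))

  lookup-∈T-map : (U : Team AP) {J : List (Fin (length U))} {j : Fin (length U)} →
    j ∈ J → lookup U j ∈T map (lookup U) J
  lookup-∈T-map U j∈J = Anyₚ.map⁺ (lose j∈J ≈T-refl)

module _ {AP : Set} {U : Team AP} (F : AsyncStutteringFn U) where

  image : Fin (length U) → Trace AP
  image i = lookup U i [ fun F i ]

  image-cong : ∀ {i j} → lookup U i ≈T lookup U j → image i ≈T image j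
  image-cong {i} {j} uᵢ≈uⱼ n a =
    trans (uᵢ≈uⱼ (fun F i n) a) (cong (λ m → lookup U j m a) (consistent F i j uᵢ≈uⱼ n))

  ∈⟦⟧⁺ : ∀ {s} i → s ≈T image i → s ∈T (U ⟦ F ⟧)
  ∈⟦⟧⁺ = Anyₚ.tabulate⁺

  ∈⟦⟧⁻ : ∀ {s} → s ∈T (U ⟦ F ⟧) → ∃[ i ] s ≈T image i
  ∈⟦⟧⁻ = Anyₚ.tabulate⁻

  InImage : Team AP → Trace AP → Set
  InImage S s = ∃[ i ] (lookup U i ∈T S × s ≈T image i)

  InImage-resp-≈T : ∀ {S s t} → s ≈T t → InImage S t → InImage S s
  InImage-resp-≈T s≈t (i , uᵢ∈S , t≈) = i , uᵢ∈S , ≈T-trans s≈t t≈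

  ∈⟦⟧⇒InImage : ∀ {s} → s ∈T (U ⟦ F ⟧) → InImage U s
  ∈⟦⟧⇒InImage s∈ = let i , s≈ = ∈⟦⟧⁻ s∈ in i , lookup-∈T U i , s≈

  InImage⇒∈⟦⟧ : ∀ {S s} → InImage S s → s ∈T (U ⟦ F ⟧)
  InImage⇒∈⟦⟧ (i , _ , s≈) = ∈⟦⟧⁺ i s≈

  InImage-mono : ∀ {S S' s} → S ⊆T S' → InImage S s → InImage S' s
  InImage-mono S⊆S' (i , uᵢ∈S , s≈) = i , ⊆T⁻ S⊆S' uᵢ∈S , s≈

  InImage-++⁻ : ∀ S₁ {S₂ s} → InImage (S₁ ++ S₂) s → InImage S₁ s ⊎ InImage S₂ s
  InImage-++⁻ S₁ (i , uᵢ∈ , s≈) =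
    Sum.map (λ uᵢ∈S₁ → i , uᵢ∈S₁ , s≈) (λ uᵢ∈S₂ → i , uᵢ∈S₂ , s≈) (Anyₚ.++⁻ S₁ uᵢ∈)

  InImage-map-lookup⁺ : ∀ {J s} → Any (λ j → s ≈T image j) J → InImage (map (lookup U) J) s
  InImage-map-lookup⁺ s≈ =
    let j , j∈J , s≈image = find s≈ in j , lookup-∈T-map U j∈J , s≈image

  InImage-map-lookup⁻ : ∀ {J s} → InImage (map (lookup U) J) s → Any (λ j → s ≈T image j) J
  InImage-map-lookup⁻ (i , uᵢ∈ , s≈) =
    Any.map (≈T-trans s≈ ∘ image-cong) (Anyₚ.map⁻ {f = lookup U} uᵢ∈)

module _ {AP : Set} {U : Team AP} (F : AsyncStutteringFn U) {S : Team AP} (S⊆U : S ⊆T U) where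

  position : Fin (length S) → Fin (length U)
  position k = Any.index (All.lookup S⊆U (∈-lookup k))

  lookup-position : ∀ k → lookup S k ≈T lookup U (position k)
  lookup-position k = Anyₚ.lookup-index (All.lookup S⊆U (∈-lookup k))

  restrict : AsyncStutteringFn S
  restrict = record
    { fun = fun F ∘ position
    ; stuttering = λ k →
        IsStutteringFn-resp-≈T (≈T-sym (lookup-position k)) (stuttering F (position k))
    ; consistent = λ k l sₖ≈sₗ → consistent F (position k) (position l)
        (≈T-trans (≈T-sym (lookup-position k)) (≈T-trans sₖ≈sₗ (lookup-position l)))
    }

  image-restrict : ∀ k → image restrict k ≈T image F (position k)
  image-restrict k = [ fun F (position k) ]-resp-≈T (lookup-position k)

  ∈restrict⟦⟧⇒InImage : ∀ {s} → s ∈T (S ⟦ restrict ⟧) → InImage F S s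
  ∈restrict⟦⟧⇒InImage s∈ =
    let k , s≈ = ∈⟦⟧⁻ restrict s∈ in
    position k ,
    ∈T-resp-≈T (≈T-sym (lookup-position k)) (lookup-∈T S k) ,
    ≈T-trans s≈ (image-restrict k)

  InImage⇒∈restrict⟦⟧ : ∀ {s} → InImage F S s → s ∈T (S ⟦ restrict ⟧)
  InImage⇒∈restrict⟦⟧ {s} (i , uᵢ∈S , s≈) = ∈⟦⟧⁺ restrict k (begin
      s                       ≈⟨ s≈ ⟩
      image F i               ≈⟨ image-cong F (≈T-trans uᵢ≈sₖ (lookup-position k)) ⟩
      image F (position k)    ≈⟨ ≈T-sym (image-restrict k) ⟩
      image restrict k        ∎)
    where
    open SetoidReasoning ≈T-setoid
    k = Any.index uᵢ∈S
    uᵢ≈sₖ = Anyₚ.lookup-index uᵢ∈S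

module _ {AP : Set} where

  sameImage⇒≡ᵃst : {U U' S S' : Team AP} (F : AsyncStutteringFn U) (F' : AsyncStutteringFn U')
    (S⊆U : S ⊆T U) (S'⊆U' : S' ⊆T U') →
    (∀ {s} → InImage F S s → InImage F' S' s) →
    (∀ {s} → InImage F' S' s → InImage F S s) →
    S ≡ᵃst S'
  sameImage⇒≡ᵃst F F' S⊆U S'⊆U' to from =
    restrict F S⊆U , restrict F' S'⊆U' ,
    ⊆T⁺ (InImage⇒∈restrict⟦⟧ F' S'⊆U' ∘ to ∘ ∈restrict⟦⟧⇒InImage F S⊆U) ,
    ⊆T⁺ (InImage⇒∈restrict⟦⟧ F S⊆U ∘ from ∘ ∈restrict⟦⟧⇒InImage F' S'⊆U')

  ≡ᵃst-respʳ-≡T : {T U V : Team AP} → T ≡ᵃst U → U ≡T V → T ≡ᵃst V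
  ≡ᵃst-respʳ-≡T (F , G , T⟦F⟧⊆U⟦G⟧ , U⟦G⟧⊆T⟦F⟧) (U⊆V , V⊆U) =
    F , restrict G V⊆U ,
    ⊆T-trans T⟦F⟧⊆U⟦G⟧
      (⊆T⁺ (InImage⇒∈restrict⟦⟧ G V⊆U ∘ InImage-mono G U⊆V ∘ ∈⟦⟧⇒InImage G)) ,
    ⊆T-trans (⊆T⁺ (InImage⇒∈⟦⟧ G ∘ ∈restrict⟦⟧⇒InImage G V⊆U)) U⟦G⟧⊆T⟦F⟧

  ≡ᵃst-[]ˡ : {U : Team AP} → [] ≡ᵃst U → U ≡ []
  ≡ᵃst-[]ˡ {[]} _ = refl
  ≡ᵃst-[]ˡ {_ ∷ _} (_ , _ , _ , () ∷ _)

  ≡ᵃst-map-lookup : {U U' S : Team AP} (F : AsyncStutteringFn U) (F' : AsyncStutteringFn U')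
    (S⊆U : S ⊆T U) {J : List (Fin (length U'))} →
    All (λ j → InImage F S (image F' j)) J →
    (∀ {s} → InImage F S s → Any (λ j → s ≈T image F' j) J) →
    S ≡ᵃst map (lookup U') J
  ≡ᵃst-map-lookup {U' = U'} F F' S⊆U sound complete =
    sameImage⇒≡ᵃst F F' S⊆U (map-lookup-⊆T U' _)
      (InImage-map-lookup⁺ F' ∘ complete)
      (λ s∈ → let j , j∈J , s≈ = find (InImage-map-lookup⁻ F' s∈) in
        InImage-resp-≈T F s≈ (All.lookup sound j∈J))

MatchesSplits : {AP : Set} → Team AP → Team AP → Set
MatchesSplits {AP} T T' = ∀ (T₁ T₂ : Team AP) → T ≡T (T₁ ++ T₂) →
  Σ (Team AP) λ T₁' → Σ (Team AP) λ T₂' →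
    (T₁' ⊆T T') × (T₂' ⊆T T') × (T' ≡T (T₁' ++ T₂'))
    × (T₁ ≡ᵃst T₁') × (T₂ ≡ᵃst T₂')

module _ {AP : Set} {T T' : Team AP} (F : AsyncStutteringFn T) (F' : AsyncStutteringFn T')
         (T⟦F⟧≡T'⟦F'⟧ : (T ⟦ F ⟧) ≡T (T' ⟦ F' ⟧)) where

  extend-to-≡ᵃst : {S : Team AP} → S ⊆T T → (P : List (Fin (length T'))) →
    All (λ j → InImage F S (image F' j)) P →
    Σ (Team AP) λ S' → S' ⊆T T' × S ≡ᵃst S' × All (λ j → lookup T' j ∈T S') P
  extend-to-≡ᵃst {S} S⊆T P P-sound =
    map (lookup T') (P ++ W) , map-lookup-⊆T T' (P ++ W) ,
    ≡ᵃst-map-lookup F F' S⊆T (Allₚ.++⁺ P-sound W-sound) complete ,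
    All.tabulate (lookup-∈T-map T' ∘ Anyₚ.++⁺ˡ)
    where
    G = restrict F S⊆T
    partner : (k : Fin (length S)) → ∃[ j ] image G k ≈T image F' j
    partner k = ∈⟦⟧⁻ F' (⊆T⁻ (proj₁ T⟦F⟧≡T'⟦F'⟧)
      (∈⟦⟧⁺ F (position F S⊆T k) (image-restrict F S⊆T k)))
    W = tabulate (proj₁ ∘ partner)
    W-sound : All (λ j → InImage F S (image F' j)) W
    W-sound = Allₚ.tabulate⁺ λ k →
      InImage-resp-≈T F (≈T-sym (proj₂ (partner k)))
        (∈restrict⟦⟧⇒InImage F S⊆T (∈⟦⟧⁺ G k ≈T-refl))
    complete : ∀ {s} → InImage F S s → Any (λ j → s ≈T image F' j) (P ++ W)
    complete s∈ = let k , s≈ = ∈⟦⟧⁻ G (InImage⇒∈restrict⟦⟧ F S⊆T s∈) in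
      Anyₚ.++⁺ʳ P (Anyₚ.tabulate⁺ k (≈T-trans s≈ (proj₂ (partner k))))

  ≡ᵃst⇒MatchesSplits : MatchesSplits T T'
  ≡ᵃst⇒MatchesSplits T₁ T₂ (T⊆T₁++T₂ , T₁++T₂⊆T) =
    let P₁ , P₂ , P₁-sound , P₂-sound , split = partition-⊎ side (allFin _)
        T₁' , T₁'⊆T' , T₁≡T₁' , P₁⊆T₁' = extend-to-≡ᵃst (Allₚ.++⁻ˡ T₁ T₁++T₂⊆T) P₁ P₁-sound
        T₂' , T₂'⊆T' , T₂≡T₂' , P₂⊆T₂' = extend-to-≡ᵃst (Allₚ.++⁻ʳ T₁ T₁++T₂⊆T) P₂ P₂-sound
    in T₁' , T₂' , T₁'⊆T' , T₂'⊆T' ,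
       (⊆T-++-byIndices P₁⊆T₁' P₂⊆T₂' (split ∘ ∈-allFin) , Allₚ.++⁺ T₁'⊆T' T₂'⊆T') ,
       T₁≡T₁' , T₂≡T₂'
    where
    side : ∀ j → InImage F T₁ (image F' j) ⊎ InImage F T₂ (image F' j)
    side j = InImage-++⁻ F T₁ (InImage-mono F T⊆T₁++T₂
      (∈⟦⟧⇒InImage F (⊆T⁻ (proj₂ T⟦F⟧≡T'⟦F'⟧) (∈⟦⟧⁺ F' j ≈T-refl))))

MatchesSplits⇒≡ᵃst : {AP : Set} (T T' : Team AP) → MatchesSplits T T' → T ≡ᵃst T'
MatchesSplits⇒≡ᵃst T T' splits =
  let T₁' , T₂' , T₁'⊆T' , _ , (T'⊆T₁'++T₂' , _) , T≡T₁' , []≡T₂' =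
        splits T [] (subst (T ≡T_) (sym (++-identityʳ T)) (≡T-refl T))
      T₁'++T₂'≡T₁' = trans (cong (T₁' ++_) (≡ᵃst-[]ˡ []≡T₂')) (++-identityʳ T₁')
  in ≡ᵃst-respʳ-≡T T≡T₁' (T₁'⊆T' , subst (T' ⊆T_) T₁'++T₂'≡T₁' T'⊆T₁'++T₂')

lemma1 : {AP : Set} (T T' : Team AP) →
    (T ≡ᵃst T') ⇔
    (∀ (T₁ T₂ : Team AP) → T ≡T (T₁ ++ T₂) →
      Σ (Team AP) λ T₁' → Σ (Team AP) λ T₂' →
        (T₁' ⊆T T') × (T₂' ⊆T T') × (T' ≡T (T₁' ++ T₂'))
        × (T₁ ≡ᵃst T₁') × (T₂ ≡ᵃst T₂'))
lemma1 T T' =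
  mk⇔ (λ (F , F' , T⟦F⟧≡T'⟦F'⟧) → ≡ᵃst⇒MatchesSplits F F' T⟦F⟧≡T'⟦F'⟧) (MatchesSplits⇒≡ᵃst T T')
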